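{- Let $f$ be the morphism on $\{\mathtt{0},\ldots,\mathtt{4}\}^*$ with $f(\mathtt{0})=\mathtt{01203}$, $f(\mathtt{1})=\mathtt{0124}$, $f(\mathtt{2})=\mathtt{0120323}$, $f(\mathtt{3})=\mathtt{01240324}$, $f(\mathtt{4})=\mathtt{01240323}$, and $g:\{\mathtt{0},\ldots,\mathtt{4}\}^*\to\{\mathtt{a},\mathtt{b},\mathtt{c},\mathtt{d},\mathtt{e}\}^*$ the morphism with $g(\mathtt{0})=\mathtt{abcdeacd}$, $g(\mathtt{1})=\mathtt{abcdbecd}$, $g(\mathtt{2})=\mathtt{abcdeacdbe}$, $g(\mathtt{3})=\mathtt{abcdbecdeacdbecd}$, $g(\mathtt{4})=\mathtt{abcdbecdeacdbe}$, and let $w_5=g(f^\omega(\mathtt{0}))$. For $d\ge 0$ let $p_{\mathtt{01240323}}=\mathtt{ecdeacdbe}\,g(\mathtt{0323}\,f(\mathtt{0323})\cdots f^{d-1}(\mathtt{0323})\,f^d(\mathtt{0323}))$ and $s_{\mathtt{01240323}}=g(f^d(\mathtt{012})\,f^{d-1}(\mathtt{012})\cdots f(\mathtt{012})\,\mathtt{012})\,\mathtt{abcdb}$. Then for every $d\ge 0$, the word $T_{\mathtt{01240323}}=p_{\mathtt{01240323}}s_{\mathtt{01240323}}$ is a conjugate of $g(f^d(\mathtt{01240323}))$ that is not a factor of $w_5$.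
   Context: $f^\omega(\mathtt{0})$ is the infinite fixed point of $f$ starting with $\mathtt{0}$. A conjugate of a word $xy$ is $yx$. Note $f^d(\mathtt{01240323})=f^{d+1}(\mathtt{4})$. -}

module Defs where

open import Data.Nat using (ℕ; zero; suc; _+_)
open import Data.List using (List; []; _∷_; _++_; concatMap; length; lookup; reverse)
open import Data.Fin using (Fin; toℕ)
open import Data.Product using (Σ; ∃; _×_; _,_)
open import Relation.Binary.PropositionalEquality using (_≡_)

data D : Set where
  d0 d1 d2 d3 d4 : D

data L : Set where
  a b c d e : L

fL : D → List D
fL d0 = d0 ∷ d1 ∷ d2 ∷ d0 ∷ d3 ∷ []
fL d1 = d0 ∷ d1 ∷ d2 ∷ d4 ∷ []
fL d2 = d0 ∷ d1 ∷ d2 ∷ d0 ∷ d3 ∷ d2 ∷ d3 ∷ []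
fL d3 = d0 ∷ d1 ∷ d2 ∷ d4 ∷ d0 ∷ d3 ∷ d2 ∷ d4 ∷ []
fL d4 = d0 ∷ d1 ∷ d2 ∷ d4 ∷ d0 ∷ d3 ∷ d2 ∷ d3 ∷ []

gL : D → List L
gL d0 = a ∷ b ∷ c ∷ d ∷ e ∷ a ∷ c ∷ d ∷ []
gL d1 = a ∷ b ∷ c ∷ d ∷ b ∷ e ∷ c ∷ d ∷ []
gL d2 = a ∷ b ∷ c ∷ d ∷ e ∷ a ∷ c ∷ d ∷ b ∷ e ∷ []
gL d3 = a ∷ b ∷ c ∷ d ∷ b ∷ e ∷ c ∷ d ∷ e ∷ a ∷ c ∷ d ∷ b ∷ e ∷ c ∷ d ∷ []
gL d4 = a ∷ b ∷ c ∷ d ∷ b ∷ e ∷ c ∷ d ∷ e ∷ a ∷ c ∷ d ∷ b ∷ e ∷ []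

f : List D → List D
f = concatMap fL

g : List D → List L
g = concatMap gL

fpow : ℕ → List D → List D
fpow zero    w = w
fpow (suc n) w = f (fpow n w)

-- total lookup with a default letter (only used at in-range indices, see below)
at : {A : Set} → A → List A → ℕ → A
at x₀ []       _       = x₀
at x₀ (x ∷ xs) zero    = x
at x₀ (x ∷ xs) (suc n) = at x₀ xs n

-- w5 = g(f^ω(0)) as an infinite word ℕ → L.
-- Since f(0) begins with 0, each g(f^k(0)) is a prefix of g(f^(k+1)(0)), and
-- |g(f^(n+1)(0))| > n, so position n of the limit is position n of g(f^(n+1)(0)).
w5 : ℕ → L
w5 n = at a (g (fpow (suc n) (d0 ∷ []))) n

FactorOf : {A : Set} → (u : List A) → (ℕ → A) → Set
FactorOf u w = ∃ λ i → (j : Fin (length u)) → w (i + toℕ j) ≡ lookup u j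

ConjugateOf : {A : Set} → List A → List A → Set
ConjugateOf u v = ∃ λ x → ∃ λ y → (u ≡ x ++ y) × (v ≡ y ++ x)

ascCat : List D → ℕ → List D
ascCat u zero    = u
ascCat u (suc n) = ascCat u n ++ fpow (suc n) u

descCat : List D → ℕ → List D
descCat u zero    = u
descCat u (suc n) = fpow (suc n) u ++ descCat u n

w0323 w012 w01240323 : List D
w0323 = d0 ∷ d3 ∷ d2 ∷ d3 ∷ []
w012 = d0 ∷ d1 ∷ d2 ∷ []
w01240323 = d0 ∷ d1 ∷ d2 ∷ d4 ∷ d0 ∷ d3 ∷ d2 ∷ d3 ∷ []

p01240323 : ℕ → List L
p01240323 n = (e ∷ c ∷ d ∷ e ∷ a ∷ c ∷ d ∷ b ∷ e ∷ []) ++ g (ascCat w0323 n)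

s01240323 : ℕ → List L
s01240323 n = g (descCat w012 n) ++ (a ∷ b ∷ c ∷ d ∷ b ∷ [])

T01240323 : ℕ → List L
T01240323 n = p01240323 n ++ s01240323 n

-- Since f(4) = 012·4·0323, induction gives f^n(01240323) = f^{n+1}(4) = Y·4·X with
-- Y = f^n(012)⋯f(012)012 and X = 0323 f(0323)⋯f^n(0323), so g(f^n(01240323)) = s·p.
--
-- For the second claim let bridge₀ = ε and bridge_{k+1} = 0323 f(bridge_k) 012, so that
-- X·Y = bridge_{n+1} and T = ecdeacdbe · g(bridge_{n+1}) · abcdb. Both morphisms can be
-- desubstituted: ecdeacdbe followed by a occurs in images of g only as the tail of g(4),
-- 40323 occurs in images of f only inside f(4), and g (resp. f) parses uniquely in front of
-- a (resp. 01). Hence an occurrence of T in w5 = g(f^ω(0)) yields a factor 4·bridge_{n+1}·y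
-- of f^ω(0) with y ∈ {1,3,4}, and 4·bridge_{k+1}·y in f(v) yields 4·bridge_k·y′ in v.
-- Descending to k = 0 gives a factor 4y, but in an image of f every 4 is followed by 0.

module Submission where

open import Defs
open import Data.Nat using (ℕ)
open import Data.Product using (_×_)
open import Relation.Nullary using (¬_)

open import Data.Bool using (T)
open import Data.Fin using (Fin; toℕ)
import Data.Fin as Fin
open import Data.Fin.Properties using (toℕ<n)
open import Data.List using (List; []; _∷_; _++_; length; lookup; take; drop; concatMap)
open import Data.List.Properties
  using (++-assoc; ++-identityʳ; ++-cancelˡ; ∷-injectiveˡ; length-++; length-++-≤ˡ; concatMap-++; drop-[])
open import Data.Nat using (zero; suc; _+_; _*_; _≤_; _<_; _<ᵇ_; z≤n; s≤s; _≤′_; ≤′-refl; ≤′-step)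
open import Data.Nat.Properties
  using (≤-trans; ≤-reflexive; <⇒≤; ≤⇒≤′; n≤1+n; +-mono-≤; +-monoʳ-≤; +-mono-≤-<; +-identityʳ;
         *-suc; *-zeroʳ; *-identityˡ; module ≤-Reasoning)
open import Data.Product using (∃; ∃₂; _,_; proj₂)
open import Data.Sum using (_⊎_; inj₁; inj₂)
open import Data.Unit using (tt)
open import Function using (_∘_; case_of_)
open import Relation.Binary.PropositionalEquality
  using (_≡_; _≢_; refl; sym; trans; cong; cong₂; module ≡-Reasoning)

module _ {A B : Set} (h : A → List B) where

  private
    drop-++-cases : ∀ i (xs ys : List B) →
                    (T (i <ᵇ length xs) × drop i (xs ++ ys) ≡ drop i xs ++ ys) ⊎ ∃ λ i′ → drop i (xs ++ ys) ≡ drop i′ ys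
    drop-++-cases zero    []       ys = inj₂ (zero , refl)
    drop-++-cases zero    (x ∷ xs) ys = inj₁ (tt , refl)
    drop-++-cases (suc i) []       ys = inj₂ (suc i , refl)
    drop-++-cases (suc i) (x ∷ xs) ys = drop-++-cases i xs ys

  -- The offset bound is a boolean test so that, for a concrete image, offsets past its end
  -- are refuted by an absurd pattern.
  drop-concatMap : ∀ v i → drop i (concatMap h v) ≡ [] ⊎
                   ∃ λ k → ∃₂ λ x v′ → ∃ λ j → T (j <ᵇ length (h x)) × drop k v ≡ x ∷ v′
                     × drop i (concatMap h v) ≡ drop j (h x) ++ concatMap h v′
  drop-concatMap []      i = inj₁ (drop-[] i)
  drop-concatMap (x ∷ v) i with drop-++-cases i (h x) (concatMap h v)
  ... | inj₁ (j<∣hx∣ , split) = inj₂ (zero , x , v , i , j<∣hx∣ , refl , split)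
  ... | inj₂ (i′ , skip) with drop-concatMap v i′
  ...   | inj₁ empty = inj₁ (trans skip empty)
  ...   | inj₂ (k , y , v′ , j , j<∣hy∣ , at-k , split) = inj₂ (suc k , y , v′ , j , j<∣hy∣ , at-k , trans skip split)

  length-concatMap-≥ : ∀ {k} → (∀ x → k ≤ length (h x)) → ∀ v → k * length v ≤ length (concatMap h v)
  length-concatMap-≥ {k} k≤∣h∣ []      = ≤-reflexive (*-zeroʳ k)
  length-concatMap-≥ {k} k≤∣h∣ (x ∷ v) = begin
    k * suc (length v)                       ≡⟨ *-suc k (length v) ⟩
    k + k * length v                         ≤⟨ +-mono-≤ (k≤∣h∣ x) (length-concatMap-≥ k≤∣h∣ v) ⟩
    length (h x) + length (concatMap h v)    ≡⟨ length-++ (h x) ⟨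
    length (h x ++ concatMap h v)            ∎
    where open ≤-Reasoning

module Synchronization {A B : Set} (h : A → List B) (m : B) (ms : List B)
                       (image-starts : ∀ x → ∃ λ u → h x ≡ m ∷ ms ++ u) where

  image-++-starts : ∀ x w → ∃ λ u → h x ++ w ≡ m ∷ ms ++ u
  image-++-starts x w with image-starts x
  ... | u , hx≡ = u ++ w , trans (cong (_++ w) hx≡) (cong (m ∷_) (++-assoc ms u w))

  image-length-≥ : ∀ x → suc (length ms) ≤ length (h x)
  image-length-≥ x with u , hx≡ ← image-starts x rewrite hx≡ = s≤s (length-++-≤ˡ ms)

  starts-with-marker : ∀ v {b s} → concatMap h v ≡ b ∷ s → ∃ λ u → b ∷ s ≡ m ∷ ms ++ u
  starts-with-marker []      ()
  starts-with-marker (x ∷ v) eq with image-++-starts x (concatMap h v)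
  ... | u , starts = u , trans (sym eq) starts

  marker-after : ∀ Z t → ∃ λ u → concatMap h Z ++ m ∷ ms ++ t ≡ m ∷ ms ++ u
  marker-after []      t = t , refl
  marker-after (x ∷ Z) t with image-++-starts x (concatMap h Z ++ m ∷ ms ++ t)
  ... | u , starts = u , trans (++-assoc (h x) (concatMap h Z) _) starts

  -- g(0) is a prefix of g(2), and f(1) of f(3) and f(4): images are told apart only by the
  -- marker with which the next image begins.
  Synchronizing : Set
  Synchronizing = ∀ x y {r u} → h y ++ concatMap h r ≡ h x ++ m ∷ ms ++ u → y ≡ x

  desubstitute : Synchronizing → ∀ Z r t → concatMap h r ≡ concatMap h Z ++ m ∷ ms ++ t →
                 ∃ λ r′ → r ≡ Z ++ r′ × concatMap h r′ ≡ m ∷ ms ++ t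
  desubstitute sync []      r       t eq = r , refl , eq
  desubstitute sync (x ∷ Z) []      t eq = case trans eq (proj₂ (marker-after (x ∷ Z) t)) of λ ()
  desubstitute sync (x ∷ Z) (y ∷ r) t eq
    with eq′ ← trans eq (++-assoc (h x) (concatMap h Z) _)
    with refl ← sync x y {r} (trans eq′ (cong (h x ++_) (proj₂ (marker-after Z t))))
    with r′ , r≡ , hr′ ← desubstitute sync Z r t (++-cancelˡ (h x) _ _ eq′)
    = r′ , cong (x ∷_) r≡ , hr′

at-++ˡ : ∀ {A : Set} (x₀ : A) xs ys {k} → k < length xs → at x₀ (xs ++ ys) k ≡ at x₀ xs k
at-++ˡ x₀ (x ∷ xs) ys {zero}  _          = refl
at-++ˡ x₀ (x ∷ xs) ys {suc k} (s≤s k<∣xs∣) = at-++ˡ x₀ xs ys k<∣xs∣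

at-agrees⇒drop≡++ : ∀ {A : Set} (x₀ : A) w i (u : List A) →
                    ((j : Fin (length u)) → at x₀ w (i + toℕ j) ≡ lookup u j) →
                    i + length u ≤ length w → ∃ λ s → drop i w ≡ u ++ s
at-agrees⇒drop≡++ x₀ w       zero    []      agree _  = w , refl
at-agrees⇒drop≡++ x₀ (x ∷ w) zero    (y ∷ u) agree (s≤s ∣u∣≤∣w∣)
  with s , w≡ ← at-agrees⇒drop≡++ x₀ w zero u (λ j → agree (Fin.suc j)) ∣u∣≤∣w∣
  = s , cong₂ _∷_ (agree Fin.zero) w≡
at-agrees⇒drop≡++ x₀ (x ∷ w) (suc i) u agree (s≤s bound) = at-agrees⇒drop≡++ x₀ w i u agree bound

g4-head g4-tail : List L
g4-head = take 5 (gL d4)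
g4-tail = drop 5 (gL d4)

descCat-suc : ∀ u n → f (descCat u n) ++ u ≡ descCat u (suc n)
descCat-suc u zero    = refl
descCat-suc u (suc n) = begin
  f (fpow (suc n) u ++ descCat u n) ++ u           ≡⟨ cong (_++ u) (concatMap-++ fL (fpow (suc n) u) (descCat u n)) ⟩
  (fpow (suc (suc n)) u ++ f (descCat u n)) ++ u   ≡⟨ ++-assoc (fpow (suc (suc n)) u) (f (descCat u n)) u ⟩
  fpow (suc (suc n)) u ++ (f (descCat u n) ++ u)   ≡⟨ cong (fpow (suc (suc n)) u ++_) (descCat-suc u n) ⟩
  fpow (suc (suc n)) u ++ descCat u (suc n)        ∎
  where open ≡-Reasoning

ascCat-suc : ∀ v n → v ++ f (ascCat v n) ≡ ascCat v (suc n)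
ascCat-suc v zero    = refl
ascCat-suc v (suc n) = begin
  v ++ f (ascCat v n ++ fpow (suc n) v)            ≡⟨ cong (v ++_) (concatMap-++ fL (ascCat v n) (fpow (suc n) v)) ⟩
  v ++ (f (ascCat v n) ++ fpow (suc (suc n)) v)    ≡⟨ ++-assoc v (f (ascCat v n)) (fpow (suc (suc n)) v) ⟨
  (v ++ f (ascCat v n)) ++ fpow (suc (suc n)) v    ≡⟨ cong (_++ fpow (suc (suc n)) v) (ascCat-suc v n) ⟩
  ascCat v (suc n) ++ fpow (suc (suc n)) v         ∎
  where open ≡-Reasoning

fpow-descCat-ascCat : ∀ {x u v} → fL x ≡ u ++ x ∷ v → ∀ n → fpow n (u ++ x ∷ v) ≡ descCat u n ++ x ∷ ascCat v n
fpow-descCat-ascCat           fx≡ zero    = refl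
fpow-descCat-ascCat {x} {u} {v} fx≡ (suc n) = begin
  f (fpow n (u ++ x ∷ v))                     ≡⟨ cong f (fpow-descCat-ascCat fx≡ n) ⟩
  f (Dₙ ++ x ∷ Aₙ)                            ≡⟨ concatMap-++ fL Dₙ (x ∷ Aₙ) ⟩
  f Dₙ ++ fL x ++ f Aₙ                        ≡⟨ cong (λ w → f Dₙ ++ w ++ f Aₙ) fx≡ ⟩
  f Dₙ ++ (u ++ x ∷ v) ++ f Aₙ                ≡⟨ cong (f Dₙ ++_) (++-assoc u (x ∷ v) (f Aₙ)) ⟩
  f Dₙ ++ u ++ x ∷ v ++ f Aₙ                  ≡⟨ ++-assoc (f Dₙ) u _ ⟨
  (f Dₙ ++ u) ++ x ∷ v ++ f Aₙ                ≡⟨ cong₂ (λ p q → p ++ x ∷ q) (descCat-suc u n) (ascCat-suc v n) ⟩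
  descCat u (suc n) ++ x ∷ ascCat v (suc n)   ∎
  where
  open ≡-Reasoning
  Dₙ = descCat u n
  Aₙ = ascCat v n

T-conjugate : ∀ n → ConjugateOf (T01240323 n) (g (fpow n w01240323))
T-conjugate n = p01240323 n , s01240323 n , refl , (begin
  g (fpow n w01240323)                 ≡⟨ cong g (fpow-descCat-ascCat refl n) ⟩
  g (Dₙ ++ d4 ∷ Aₙ)                    ≡⟨ concatMap-++ gL Dₙ (d4 ∷ Aₙ) ⟩
  g Dₙ ++ g4-head ++ g4-tail ++ g Aₙ   ≡⟨ ++-assoc (g Dₙ) g4-head _ ⟨
  s01240323 n ++ p01240323 n           ∎)
  where
  open ≡-Reasoning
  Aₙ = ascCat w0323 n
  Dₙ = descCat w012 n

bridge : ℕ → List D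
bridge zero    = []
bridge (suc k) = w0323 ++ f (bridge k) ++ w012

ascCat-++-descCat : ∀ n → ascCat w0323 n ++ descCat w012 n ≡ bridge (suc n)
ascCat-++-descCat zero    = refl
ascCat-++-descCat (suc n) = begin
  ascCat w0323 (suc n) ++ descCat w012 (suc n)              ≡⟨ cong₂ _++_ (ascCat-suc w0323 n) (descCat-suc w012 n) ⟨
  (w0323 ++ f Aₙ) ++ (f Dₙ ++ w012)                        ≡⟨ ++-assoc w0323 (f Aₙ) _ ⟩
  w0323 ++ f Aₙ ++ f Dₙ ++ w012                            ≡⟨ cong (w0323 ++_) (++-assoc (f Aₙ) (f Dₙ) w012) ⟨
  w0323 ++ (f Aₙ ++ f Dₙ) ++ w012                          ≡⟨ cong (λ w → w0323 ++ w ++ w012) (concatMap-++ fL Aₙ Dₙ) ⟨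
  w0323 ++ f (Aₙ ++ Dₙ) ++ w012                            ≡⟨ cong (λ w → w0323 ++ f w ++ w012) (ascCat-++-descCat n) ⟩
  bridge (suc (suc n))                                      ∎
  where
  open ≡-Reasoning
  Aₙ = ascCat w0323 n
  Dₙ = descCat w012 n

T-bridge : ∀ n s → T01240323 n ++ s ≡ g4-tail ++ g (bridge (suc n)) ++ g4-head ++ s
T-bridge n s = cong (g4-tail ++_) (begin
  (g Aₙ ++ g Dₙ ++ g4-head) ++ s    ≡⟨ ++-assoc (g Aₙ) (g Dₙ ++ g4-head) s ⟩
  g Aₙ ++ (g Dₙ ++ g4-head) ++ s    ≡⟨ cong (g Aₙ ++_) (++-assoc (g Dₙ) g4-head s) ⟩
  g Aₙ ++ g Dₙ ++ g4-head ++ s      ≡⟨ ++-assoc (g Aₙ) (g Dₙ) (g4-head ++ s) ⟨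
  (g Aₙ ++ g Dₙ) ++ g4-head ++ s    ≡⟨ cong (_++ g4-head ++ s) (concatMap-++ gL Aₙ Dₙ) ⟨
  g (Aₙ ++ Dₙ) ++ g4-head ++ s      ≡⟨ cong (λ w → g w ++ g4-head ++ s) (ascCat-++-descCat n) ⟩
  g (bridge (suc n)) ++ g4-head ++ s ∎)
  where
  open ≡-Reasoning
  Aₙ = ascCat w0323 n
  Dₙ = descCat w012 n

f-image-starts : ∀ x → ∃ λ u → fL x ≡ d0 ∷ d1 ∷ u
f-image-starts d0 = _ , refl
f-image-starts d1 = _ , refl
f-image-starts d2 = _ , refl
f-image-starts d3 = _ , refl
f-image-starts d4 = _ , refl

g-image-starts : ∀ x → ∃ λ u → gL x ≡ a ∷ u
g-image-starts d0 = _ , refl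
g-image-starts d1 = _ , refl
g-image-starts d2 = _ , refl
g-image-starts d3 = _ , refl
g-image-starts d4 = _ , refl

module F = Synchronization fL d0 (d1 ∷ []) f-image-starts
module G = Synchronization gL a [] g-image-starts

f-synchronizing : F.Synchronizing
f-synchronizing d0 d0 _  = refl
f-synchronizing d0 d1 ()
f-synchronizing d0 d2 ()
f-synchronizing d0 d3 ()
f-synchronizing d0 d4 ()
f-synchronizing d1 d0 ()
f-synchronizing d1 d1 _  = refl
f-synchronizing d1 d2 ()
f-synchronizing d1 d3 ()
f-synchronizing d1 d4 ()
f-synchronizing d2 d0 {r} eq = case proj₂ (F.starts-with-marker r (cong (drop 5) eq)) of λ ()
f-synchronizing d2 d1 ()
f-synchronizing d2 d2 _  = refl
f-synchronizing d2 d3 ()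
f-synchronizing d2 d4 ()
f-synchronizing d3 d0 ()
f-synchronizing d3 d1 {r} eq = case proj₂ (F.starts-with-marker r (cong (drop 4) eq)) of λ ()
f-synchronizing d3 d2 ()
f-synchronizing d3 d3 _  = refl
f-synchronizing d3 d4 ()
f-synchronizing d4 d0 ()
f-synchronizing d4 d1 {r} eq = case proj₂ (F.starts-with-marker r (cong (drop 4) eq)) of λ ()
f-synchronizing d4 d2 ()
f-synchronizing d4 d3 ()
f-synchronizing d4 d4 _  = refl

g-synchronizing : G.Synchronizing
g-synchronizing d0 d0 _  = refl
g-synchronizing d0 d1 ()
g-synchronizing d0 d2 ()
g-synchronizing d0 d3 ()
g-synchronizing d0 d4 ()
g-synchronizing d1 d0 ()
g-synchronizing d1 d1 _  = refl
g-synchronizing d1 d2 ()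
g-synchronizing d1 d3 ()
g-synchronizing d1 d4 ()
g-synchronizing d2 d0 {r} eq = case proj₂ (G.starts-with-marker r (cong (drop 8) eq)) of λ ()
g-synchronizing d2 d1 ()
g-synchronizing d2 d2 _  = refl
g-synchronizing d2 d3 ()
g-synchronizing d2 d4 ()
g-synchronizing d3 d0 ()
g-synchronizing d3 d1 {r} eq = case proj₂ (G.starts-with-marker r (cong (drop 8) eq)) of λ ()
g-synchronizing d3 d2 ()
g-synchronizing d3 d3 _  = refl
g-synchronizing d3 d4 {r} eq = case proj₂ (G.starts-with-marker r (cong (drop 14) eq)) of λ ()
g-synchronizing d4 d0 ()
g-synchronizing d4 d1 {r} eq = case proj₂ (G.starts-with-marker r (cong (drop 8) eq)) of λ ()
g-synchronizing d4 d2 ()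
g-synchronizing d4 d3 ()
g-synchronizing d4 d4 _  = refl

g-locate-g4-tail : ∀ x j {v t} → T (j <ᵇ length (gL x)) →
           drop j (gL x) ++ g v ≡ g4-tail ++ a ∷ t → x ≡ d4 × j ≡ 5
g-locate-g4-tail d0 0 _ ()
g-locate-g4-tail d0 1 _ ()
g-locate-g4-tail d0 2 _ ()
g-locate-g4-tail d0 3 _ ()
g-locate-g4-tail d0 4 _ ()
g-locate-g4-tail d0 5 _ ()
g-locate-g4-tail d0 6 _ ()
g-locate-g4-tail d0 7 _ ()
g-locate-g4-tail d0 (suc (suc (suc (suc (suc (suc (suc (suc _)))))))) () _
g-locate-g4-tail d1 0 _ ()
g-locate-g4-tail d1 1 _ ()
g-locate-g4-tail d1 2 _ ()
g-locate-g4-tail d1 3 _ ()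
g-locate-g4-tail d1 4 _ ()
g-locate-g4-tail d1 5 {v} _ eq = case proj₂ (G.starts-with-marker v (cong (drop 3) eq)) of λ ()
g-locate-g4-tail d1 6 _ ()
g-locate-g4-tail d1 7 _ ()
g-locate-g4-tail d1 (suc (suc (suc (suc (suc (suc (suc (suc _)))))))) () _
g-locate-g4-tail d2 0 _ ()
g-locate-g4-tail d2 1 _ ()
g-locate-g4-tail d2 2 _ ()
g-locate-g4-tail d2 3 _ ()
g-locate-g4-tail d2 4 _ ()
g-locate-g4-tail d2 5 _ ()
g-locate-g4-tail d2 6 _ ()
g-locate-g4-tail d2 7 _ ()
g-locate-g4-tail d2 8 _ ()
g-locate-g4-tail d2 9 {v} _ eq = case proj₂ (G.starts-with-marker v (cong (drop 1) eq)) of λ ()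
g-locate-g4-tail d2 (suc (suc (suc (suc (suc (suc (suc (suc (suc (suc _)))))))))) () _
g-locate-g4-tail d3 0 _ ()
g-locate-g4-tail d3 1 _ ()
g-locate-g4-tail d3 2 _ ()
g-locate-g4-tail d3 3 _ ()
g-locate-g4-tail d3 4 _ ()
g-locate-g4-tail d3 5 _ ()
g-locate-g4-tail d3 6 _ ()
g-locate-g4-tail d3 7 _ ()
g-locate-g4-tail d3 8 _ ()
g-locate-g4-tail d3 9 _ ()
g-locate-g4-tail d3 10 _ ()
g-locate-g4-tail d3 11 _ ()
g-locate-g4-tail d3 12 _ ()
g-locate-g4-tail d3 13 {v} _ eq = case proj₂ (G.starts-with-marker v (cong (drop 3) eq)) of λ ()
g-locate-g4-tail d3 14 _ ()
g-locate-g4-tail d3 15 _ ()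
g-locate-g4-tail d3 (suc (suc (suc (suc (suc (suc (suc (suc (suc (suc (suc (suc (suc (suc (suc (suc _)))))))))))))))) () _
g-locate-g4-tail d4 0 _ ()
g-locate-g4-tail d4 1 _ ()
g-locate-g4-tail d4 2 _ ()
g-locate-g4-tail d4 3 _ ()
g-locate-g4-tail d4 4 _ ()
g-locate-g4-tail d4 5 _ _ = refl , refl
g-locate-g4-tail d4 6 _ ()
g-locate-g4-tail d4 7 _ ()
g-locate-g4-tail d4 8 _ ()
g-locate-g4-tail d4 9 _ ()
g-locate-g4-tail d4 10 _ ()
g-locate-g4-tail d4 11 _ ()
g-locate-g4-tail d4 12 _ ()
g-locate-g4-tail d4 13 {v} _ eq = case proj₂ (G.starts-with-marker v (cong (drop 1) eq)) of λ ()
g-locate-g4-tail d4 (suc (suc (suc (suc (suc (suc (suc (suc (suc (suc (suc (suc (suc (suc _)))))))))))))) () _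

f-locate-40323 : ∀ x j {v t} → T (j <ᵇ length (fL x)) →
           drop j (fL x) ++ f v ≡ d4 ∷ d0 ∷ d3 ∷ d2 ∷ d3 ∷ t → x ≡ d4 × j ≡ 3
f-locate-40323 d0 0 _ ()
f-locate-40323 d0 1 _ ()
f-locate-40323 d0 2 _ ()
f-locate-40323 d0 3 _ ()
f-locate-40323 d0 4 _ ()
f-locate-40323 d0 (suc (suc (suc (suc (suc _))))) () _
f-locate-40323 d1 0 _ ()
f-locate-40323 d1 1 _ ()
f-locate-40323 d1 2 _ ()
f-locate-40323 d1 3 {v} _ eq = case proj₂ (F.starts-with-marker v (cong (drop 1) eq)) of λ ()
f-locate-40323 d1 (suc (suc (suc (suc _)))) () _
f-locate-40323 d2 0 _ ()
f-locate-40323 d2 1 _ ()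
f-locate-40323 d2 2 _ ()
f-locate-40323 d2 3 _ ()
f-locate-40323 d2 4 _ ()
f-locate-40323 d2 5 _ ()
f-locate-40323 d2 6 _ ()
f-locate-40323 d2 (suc (suc (suc (suc (suc (suc (suc _))))))) () _
f-locate-40323 d3 0 _ ()
f-locate-40323 d3 1 _ ()
f-locate-40323 d3 2 _ ()
f-locate-40323 d3 3 _ ()
f-locate-40323 d3 4 _ ()
f-locate-40323 d3 5 _ ()
f-locate-40323 d3 6 _ ()
f-locate-40323 d3 7 {v} _ eq = case proj₂ (F.starts-with-marker v (cong (drop 1) eq)) of λ ()
f-locate-40323 d3 (suc (suc (suc (suc (suc (suc (suc (suc _)))))))) () _
f-locate-40323 d4 0 _ ()
f-locate-40323 d4 1 _ ()
f-locate-40323 d4 2 _ ()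
f-locate-40323 d4 3 _ _ = refl , refl
f-locate-40323 d4 4 _ ()
f-locate-40323 d4 5 _ ()
f-locate-40323 d4 6 _ ()
f-locate-40323 d4 7 _ ()
f-locate-40323 d4 (suc (suc (suc (suc (suc (suc (suc (suc _)))))))) () _

f-4-then-0 : ∀ x j {v y s} → T (j <ᵇ length (fL x)) → drop j (fL x) ++ f v ≡ d4 ∷ y ∷ s → y ≡ d0
f-4-then-0 d0 0 _ ()
f-4-then-0 d0 1 _ ()
f-4-then-0 d0 2 _ ()
f-4-then-0 d0 3 _ ()
f-4-then-0 d0 4 _ ()
f-4-then-0 d0 (suc (suc (suc (suc (suc _))))) () _
f-4-then-0 d1 0 _ ()
f-4-then-0 d1 1 _ ()
f-4-then-0 d1 2 _ ()
f-4-then-0 d1 3 {v} _ eq = ∷-injectiveˡ (proj₂ (F.starts-with-marker v (cong (drop 1) eq)))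
f-4-then-0 d1 (suc (suc (suc (suc _)))) () _
f-4-then-0 d2 0 _ ()
f-4-then-0 d2 1 _ ()
f-4-then-0 d2 2 _ ()
f-4-then-0 d2 3 _ ()
f-4-then-0 d2 4 _ ()
f-4-then-0 d2 5 _ ()
f-4-then-0 d2 6 _ ()
f-4-then-0 d2 (suc (suc (suc (suc (suc (suc (suc _))))))) () _
f-4-then-0 d3 0 _ ()
f-4-then-0 d3 1 _ ()
f-4-then-0 d3 2 _ ()
f-4-then-0 d3 3 _ refl = refl
f-4-then-0 d3 4 _ ()
f-4-then-0 d3 5 _ ()
f-4-then-0 d3 6 _ ()
f-4-then-0 d3 7 {v} _ eq = ∷-injectiveˡ (proj₂ (F.starts-with-marker v (cong (drop 1) eq)))
f-4-then-0 d3 (suc (suc (suc (suc (suc (suc (suc (suc _)))))))) () _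
f-4-then-0 d4 0 _ ()
f-4-then-0 d4 1 _ ()
f-4-then-0 d4 2 _ ()
f-4-then-0 d4 3 _ refl = refl
f-4-then-0 d4 4 _ ()
f-4-then-0 d4 5 _ ()
f-4-then-0 d4 6 _ ()
f-4-then-0 d4 7 _ ()
f-4-then-0 d4 (suc (suc (suc (suc (suc (suc (suc (suc _)))))))) () _

-- The letters whose g-image begins with abcdb, equivalently whose f-image begins with 0124.
data Is134 : D → Set where
  is1 : Is134 d1
  is3 : Is134 d3
  is4 : Is134 d4

data Starts134 : List D → Set where
  starts134 : ∀ {y} → Is134 y → ∀ r → Starts134 (y ∷ r)

g-abcdb⇒Starts134 : ∀ r {t} → g r ≡ g4-head ++ t → Starts134 r
g-abcdb⇒Starts134 []       ()
g-abcdb⇒Starts134 (d0 ∷ r) ()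
g-abcdb⇒Starts134 (d1 ∷ r) _ = starts134 is1 r
g-abcdb⇒Starts134 (d2 ∷ r) ()
g-abcdb⇒Starts134 (d3 ∷ r) _ = starts134 is3 r
g-abcdb⇒Starts134 (d4 ∷ r) _ = starts134 is4 r

f-012⇒Starts134 : ∀ r {s} → f r ≡ d0 ∷ d1 ∷ d2 ∷ s → Starts134 s → Starts134 r
f-012⇒Starts134 []       ()   _
f-012⇒Starts134 (d0 ∷ r) refl (starts134 () _)
f-012⇒Starts134 (d1 ∷ r) _    _ = starts134 is1 r
f-012⇒Starts134 (d2 ∷ r) refl (starts134 () _)
f-012⇒Starts134 (d3 ∷ r) _    _ = starts134 is3 r
f-012⇒Starts134 (d4 ∷ r) _    _ = starts134 is4 r

Occurs : List D → List D → Set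
Occurs Z v = ∃₂ λ i s → drop i v ≡ d4 ∷ Z ++ s × Starts134 s

g-occurrence⇒Occurs : ∀ Z v i {s} →
  drop i (g v) ≡ g4-tail ++ g Z ++ g4-head ++ s → Occurs Z v
g-occurrence⇒Occurs Z v i {s} occ with drop-concatMap gL v i
... | inj₁ empty = case trans (sym empty) occ of λ ()
... | inj₂ (k , x , v′ , j , j<∣gx∣ , at-k , split)
  with occ′ ← trans (sym split) occ
  with refl , refl ← g-locate-g4-tail x j {v′} j<∣gx∣ (trans occ′ (cong (g4-tail ++_) (proj₂ (G.marker-after Z _))))
  with r , v′≡ , gr ← G.desubstitute g-synchronizing Z v′ (b ∷ c ∷ d ∷ b ∷ s) (++-cancelˡ g4-tail _ _ occ′)
  = k , r , trans at-k (cong (d4 ∷_) v′≡) , g-abcdb⇒Starts134 r gr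

Occurs-desubstitute : ∀ Z v → Occurs (w0323 ++ f Z ++ w012) (f v) → Occurs Z v
Occurs-desubstitute Z v (i , s , at-i , s-134) with drop-concatMap fL v i
... | inj₁ empty = case trans (sym empty) at-i of λ ()
... | inj₂ (k , x , v′ , j , j<∣fx∣ , at-k , split)
  with occ ← trans (sym split) at-i
  with refl , refl ← f-locate-40323 x j {v′} j<∣fx∣ occ
  with r , v′≡ , fr ← F.desubstitute f-synchronizing Z v′ (d2 ∷ s) (trans (++-cancelˡ (d4 ∷ w0323) _ _ occ) (++-assoc (f Z) w012 s))
  = k , r , trans at-k (cong (d4 ∷_) v′≡) , f-012⇒Starts134 r fr s-134

¬Occurs-[]-f : ∀ v → ¬ Occurs [] (f v)
¬Occurs-[]-f v (i , _ , at-i , starts134 y-134 _) with drop-concatMap fL v i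
... | inj₁ empty = case trans (sym empty) at-i of λ ()
... | inj₂ (k , x , v′ , j , j<∣fx∣ , at-k , split)
  with refl ← f-4-then-0 x j {v′} j<∣fx∣ (trans (sym split) at-i)
  = case y-134 of λ ()

¬Occurs-d0 : ∀ Z → ¬ Occurs Z (d0 ∷ [])
¬Occurs-d0 Z (zero        , _ , () , _)
¬Occurs-d0 Z (suc zero    , _ , () , _)
¬Occurs-d0 Z (suc (suc _) , _ , () , _)

¬Occurs-bridge : ∀ k M → ¬ Occurs (bridge k) (fpow M (d0 ∷ []))
¬Occurs-bridge k       zero    = ¬Occurs-d0 (bridge k)
¬Occurs-bridge zero    (suc M) = ¬Occurs-[]-f (fpow M (d0 ∷ []))
¬Occurs-bridge (suc k) (suc M) = ¬Occurs-bridge k M ∘ Occurs-desubstitute (bridge k) (fpow M (d0 ∷ []))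

T-not-in-g-fpow : ∀ n M i s → drop i (g (fpow M (d0 ∷ []))) ≢ T01240323 n ++ s
T-not-in-g-fpow n M i s occ =
  ¬Occurs-bridge (suc n) M (g-occurrence⇒Occurs (bridge (suc n)) _ i (trans occ (T-bridge n s)))

fpow-d0-suc-prefix : ∀ n → ∃ λ R → fpow (suc n) (d0 ∷ []) ≡ fpow n (d0 ∷ []) ++ R
fpow-d0-suc-prefix zero = d1 ∷ d2 ∷ d0 ∷ d3 ∷ [] , refl
fpow-d0-suc-prefix (suc n) with R , R-suffix ← fpow-d0-suc-prefix n =
  f R , trans (cong f R-suffix) (concatMap-++ fL (fpow n (d0 ∷ [])) R)

fpow-d0-prefix : ∀ {k M} → k ≤′ M → ∃ λ R → fpow M (d0 ∷ []) ≡ fpow k (d0 ∷ []) ++ R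
fpow-d0-prefix ≤′-refl = [] , sym (++-identityʳ _)
fpow-d0-prefix {k} (≤′-step {M} k≤′M)
  with R₁ , e₁ ← fpow-d0-prefix k≤′M | R₂ , e₂ ← fpow-d0-suc-prefix M =
  R₁ ++ R₂ , trans e₂ (trans (cong (_++ R₂) e₁) (++-assoc (fpow k (d0 ∷ [])) R₁ R₂))

length-fpow-d0 : ∀ n → n < length (fpow n (d0 ∷ []))
length-fpow-d0 zero    = s≤s z≤n
length-fpow-d0 (suc n) = begin-strict
  suc n          <⟨ +-mono-≤-< (≤-trans (s≤s z≤n) ih) ih ⟩
  ℓ + ℓ          ≡⟨ cong (ℓ +_) (+-identityʳ ℓ) ⟨
  2 * ℓ          ≤⟨ length-concatMap-≥ fL F.image-length-≥ w ⟩
  length (f w)   ∎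
  where
  open ≤-Reasoning
  w = fpow n (d0 ∷ [])
  ℓ = length w
  ih = length-fpow-d0 n

length-g-≥ : ∀ w → length w ≤ length (g w)
length-g-≥ w = ≤-trans (≤-reflexive (sym (*-identityˡ (length w)))) (length-concatMap-≥ gL G.image-length-≥ w)

w5-prefix : ∀ p M → p < M → w5 p ≡ at a (g (fpow M (d0 ∷ []))) p
w5-prefix p M p<M with R , prefix ← fpow-d0-prefix (≤⇒≤′ p<M) = sym (begin
  at a (g (fpow M (d0 ∷ []))) p   ≡⟨ cong (λ w → at a (g w) p) prefix ⟩
  at a (g (P ++ R)) p             ≡⟨ cong (λ w → at a w p) (concatMap-++ gL P R) ⟩
  at a (g P ++ g R) p             ≡⟨ at-++ˡ a (g P) (g R) (≤-trans (<⇒≤ (length-fpow-d0 (suc p))) (length-g-≥ P)) ⟩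
  at a (g P) p                    ∎)
  where
  open ≡-Reasoning
  P = fpow (suc p) (d0 ∷ [])

factor-of-w5 : ∀ {u} → FactorOf u w5 → ∃ λ M → ∃₂ λ i s → drop i (g (fpow M (d0 ∷ []))) ≡ u ++ s
factor-of-w5 {u} (i , agree) = M , i , at-agrees⇒drop≡++ a (g (fpow M (d0 ∷ []))) i u agree′ fits
  where
  M = suc (i + length u)
  agree′ : (j : Fin (length u)) → at a (g (fpow M (d0 ∷ []))) (i + toℕ j) ≡ lookup u j
  agree′ j = trans (sym (w5-prefix (i + toℕ j) M (s≤s (+-monoʳ-≤ i (<⇒≤ (toℕ<n j)))))) (agree j)
  fits : i + length u ≤ length (g (fpow M (d0 ∷ [])))
  fits = ≤-trans (n≤1+n _) (≤-trans (<⇒≤ (length-fpow-d0 M)) (length-g-≥ (fpow M (d0 ∷ []))))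

mainTheorem5 : (n : ℕ) → ConjugateOf (T01240323 n) (g (fpow n w01240323)) × ¬ FactorOf (T01240323 n) w5
mainTheorem5 n = T-conjugate n , λ factor →
  let M , i , s , occ = factor-of-w5 factor in T-not-in-g-fpow n M i s occ
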